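{- Let $L$ be an overlap algebra and let $L_j$ be an open sublocale of $L$. Then $L_j$ (as a frame) is an overlap algebra.
   Context: Work constructively (intuitionistic logic, no choice). A positivity predicate on a complete lattice $L$ is a unary predicate $\mathrm{Pos}$ such that: (i) $\mathrm{Pos}(x)$ and $x\leq y$ imply $\mathrm{Pos}(y)$; (ii) $\mathrm{Pos}(\bigvee X)$ implies $\mathrm{Pos}(x)$ for some $x\in X$; (iii) if $\mathrm{Pos}(x)\Rightarrow x\leq y$, then $x\leq y$. An overlap algebra is a frame with a positivity predicate such that for all $x,y$: if $\forall z\,(\mathrm{Pos}(z\wedge x)\Rightarrow\mathrm{Pos}(z\wedge y))$ then $x\leq y$. A nucleus on a frame $L$ is a function $j:L\to L$ with $x\leq j(x)=j(j(x))$ and $j(x\wedge y)=j(x)\wedge j(y)$; the corresponding sublocale is the frame $L_j=\{jx\mid x\in L\}$ (with the order of $L$). A sublocale is open if its nucleus has the form $j(x)=a\to x$ for some $a\in L$, where $\to$ is the Heyting implication of $L$. -}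

module Defs where

open import Level using (Level; suc)
open import Data.Product using (Σ; Σ-syntax; ∃; _×_; _,_; proj₁; proj₂)
open import Relation.Binary.PropositionalEquality using (_≡_; refl; trans; cong; cong₂; sym)

Subset : ∀ {ℓ} → Set ℓ → Set (suc ℓ)
Subset {ℓ} A = A → Set ℓ

record LatOps (ℓ : Level) : Set (suc ℓ) where
  field
    Carrier : Set ℓ
    _≤_ : Carrier → Carrier → Set ℓ
    _∧_ : Carrier → Carrier → Carrier
    ⋁ : Subset Carrier → Carrier

-- Distributivity follows from the implication.
record Frame (ℓ : Level) : Set (suc ℓ) where
  field
    ops : LatOps ℓ
  open LatOps ops public
  field
    ≤-refl    : ∀ {x} → x ≤ x
    ≤-trans   : ∀ {x y z} → x ≤ y → y ≤ z → x ≤ z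
    ≤-antisym : ∀ {x y} → x ≤ y → y ≤ x → x ≡ y
    ∧-lb₁     : ∀ {x y} → (x ∧ y) ≤ x
    ∧-lb₂     : ∀ {x y} → (x ∧ y) ≤ y
    ∧-glb     : ∀ {x y z} → z ≤ x → z ≤ y → z ≤ (x ∧ y)
    ⋁-ub      : ∀ (X : Subset Carrier) {x} → X x → x ≤ ⋁ X
    ⋁-least   : ∀ (X : Subset Carrier) {y} → (∀ x → X x → x ≤ y) → ⋁ X ≤ y
    _⇒_       : Carrier → Carrier → Carrier
    ⇒-intro   : ∀ {x a b} → (x ∧ a) ≤ b → x ≤ (a ⇒ b)
    ⇒-elim    : ∀ {x a b} → x ≤ (a ⇒ b) → (x ∧ a) ≤ b

record IsPositivity {ℓ} (L : LatOps ℓ) (Pos : LatOps.Carrier L → Set ℓ) : Set (suc ℓ) where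
  open LatOps L
  field
    pos-mono : ∀ {x y} → Pos x → x ≤ y → Pos y
    pos-join : ∀ (X : Subset Carrier) → Pos (⋁ X) → Σ[ x ∈ Carrier ] (X x × Pos x)
    pos-pos  : ∀ {x y} → (Pos x → x ≤ y) → x ≤ y

record IsOverlapAlgebra {ℓ} (L : LatOps ℓ) (Pos : LatOps.Carrier L → Set ℓ) : Set (suc ℓ) where
  open LatOps L
  field
    isPositivity : IsPositivity L Pos
    overlap-ax : ∀ {x y} → (∀ z → Pos (z ∧ x) → Pos (z ∧ y)) → x ≤ y

record Nucleus {ℓ} (L : Frame ℓ) : Set ℓ where
  open Frame L
  field
    j         : Carrier → Carrier
    inflation : ∀ {x} → x ≤ j x
    idem      : ∀ {x} → j (j x) ≡ j x
    pres-∧    : ∀ {x y} → j (x ∧ y) ≡ (j x ∧ j y)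

IsOpen : ∀ {ℓ} {L : Frame ℓ} → Nucleus L → Set ℓ
IsOpen {L = L} N = Σ[ a ∈ Carrier ] (∀ x → j x ≡ (a ⇒ x))
  where open Frame L
        open Nucleus N

-- Elements are represented as elements x of L with j x ≡ x
-- (exactly the elements of the form j y).
sublocale : ∀ {ℓ} {L : Frame ℓ} → Nucleus L → LatOps ℓ
sublocale {ℓ} {L} N = record
  { Carrier = C
  ; _≤_ = λ u v → proj₁ u ≤ proj₁ v
  ; _∧_ = λ u v → (proj₁ u ∧ proj₁ v) , meetFix u v
  ; ⋁ = λ X → j (⋁ (λ x → Σ[ p ∈ j x ≡ x ] X (x , p))) , idem
  }
  where
    open Frame L
    open Nucleus N
    C : Set ℓ
    C = Σ[ x ∈ Carrier ] (j x ≡ x)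
    meetFix : (u v : C) → j (proj₁ u ∧ proj₁ v) ≡ (proj₁ u ∧ proj₁ v)
    meetFix (x , p) (y , q) = trans pres-∧ (cong₂ _∧_ p q)

-- Let j x = a ⇒ x be an open nucleus on the overlap algebra (L, Pos).  On the
-- sublocale L_j we use the positivity predicate  Pos_j u = Pos (a ∧ u),
-- i.e. positivity of the part of u lying inside the open a.
--
-- Two facts about the open nucleus do all the work:
--   * modus ponens    a ∧ j w ≤ w ;
--   * transposition   a ∧ x ≤ y  implies  x ≤ j y, so x ≤ y whenever y is fixed by j.
-- Together with frame distributivity  a ∧ ⋁ X ≤ ⋁ { a ∧ x | x ∈ X }  they let
-- every axiom for Pos_j on L_j be reduced to the corresponding axiom for Pos
-- on L: joins in L_j are j of joins in L, and modus ponens strips the j off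
-- after meeting with a; inequalities a ∧ x ≤ y proved in L transpose to x ≤ y
-- in L_j.  For the overlap axiom the test elements w of L are replaced by the
-- elements j w of L_j.

module Submission where

open import Defs
open import Data.Product using (Σ-syntax; _×_; _,_; proj₁; proj₂)
open import Relation.Binary.PropositionalEquality using (_≡_; refl; sym)

module FrameFacts {ℓ} (L : Frame ℓ) where
  open Frame L

  ≡⇒≤ : ∀ {x y} → x ≡ y → x ≤ y
  ≡⇒≤ refl = ≤-refl

  ∧-mono : ∀ {x x′ y y′} → x ≤ x′ → y ≤ y′ → (x ∧ y) ≤ (x′ ∧ y′)
  ∧-mono p q = ∧-glb (≤-trans ∧-lb₁ p) (≤-trans ∧-lb₂ q)

  meetImage : Carrier → Subset Carrier → Subset Carrier
  meetImage a X z = Σ[ x ∈ Carrier ] (X x × z ≡ (a ∧ x))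

  -- Frame distributivity (the nontrivial inequality), obtained from the
  -- Heyting implication: each x ∈ X lies below a ⇒ ⋁ { a ∧ x | x ∈ X }.
  ∧-distrib-⋁ : ∀ a (X : Subset Carrier) → (a ∧ ⋁ X) ≤ ⋁ (meetImage a X)
  ∧-distrib-⋁ a X =
    ≤-trans (∧-glb ∧-lb₂ ∧-lb₁)
      (⇒-elim (⋁-least X λ x x∈X →
        ⇒-intro (≤-trans (∧-glb ∧-lb₂ ∧-lb₁) (⋁-ub (meetImage a X) (x , x∈X , refl)))))

module OpenNucleusFacts {ℓ} {L : Frame ℓ} (N : Nucleus L)
    (a : Frame.Carrier L) (j-open : ∀ x → Nucleus.j N x ≡ Frame._⇒_ L a x) where
  open Frame L
  open Nucleus N
  open FrameFacts L

  modus-ponens : ∀ {w} → (a ∧ j w) ≤ w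
  modus-ponens {w} = ≤-trans (∧-glb ∧-lb₂ ∧-lb₁) (⇒-elim (≡⇒≤ (j-open w)))

  -- Transposition across the adjunction (a ∧ -) ⊣ (a ⇒ -) = j.
  transpose : ∀ {x y} → (a ∧ x) ≤ y → x ≤ j y
  transpose h = ≤-trans (⇒-intro (≤-trans (∧-glb ∧-lb₂ ∧-lb₁) h)) (≡⇒≤ (sym (j-open _)))

  below-fixed : ∀ {x y} → j y ≡ y → (a ∧ x) ≤ y → x ≤ y
  below-fixed jy≡y h = ≤-trans (transpose h) (≡⇒≤ jy≡y)

module OpenSublocale {ℓ} (L : Frame ℓ) (Pos : Frame.Carrier L → Set ℓ)
    (OA : IsOverlapAlgebra (Frame.ops L) Pos)
    (N : Nucleus L) (a : Frame.Carrier L) (j-open : ∀ x → Nucleus.j N x ≡ Frame._⇒_ L a x) where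
  open Frame L
  open Nucleus N
  open IsOverlapAlgebra OA
  open IsPositivity isPositivity
  open FrameFacts L
  open OpenNucleusFacts N a j-open

  Lj : LatOps ℓ
  Lj = sublocale N

  PosJ : LatOps.Carrier Lj → Set ℓ
  PosJ u = Pos (a ∧ proj₁ u)

  posJ-mono : ∀ {u v} → PosJ u → LatOps._≤_ Lj u v → PosJ v
  posJ-mono p u≤v = pos-mono p (∧-mono ≤-refl u≤v)

  -- A positive join in L_j has a positive member: a ∧ j(⋁ X) ≤ a ∧ ⋁ X by
  -- modus ponens, and the latter is the join of the meets a ∧ x.
  posJ-join : ∀ (X : Subset (LatOps.Carrier Lj)) → PosJ (LatOps.⋁ Lj X)
            → Σ[ u ∈ LatOps.Carrier Lj ] (X u × PosJ u)
  posJ-join X p = witness (pos-join (meetImage a X′) (pos-mono p below-join))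
    where
      X′ : Subset Carrier
      X′ x = Σ[ jx≡x ∈ j x ≡ x ] X (x , jx≡x)

      below-join : (a ∧ j (⋁ X′)) ≤ ⋁ (meetImage a X′)
      below-join = ≤-trans (∧-glb ∧-lb₁ modus-ponens) (∧-distrib-⋁ a X′)

      witness : Σ[ z ∈ Carrier ] (meetImage a X′ z × Pos z)
              → Σ[ u ∈ LatOps.Carrier Lj ] (X u × PosJ u)
      witness (_ , (x , (jx≡x , x∈X) , refl) , pz) = (x , jx≡x) , x∈X , pz

  -- Positivity-splitting: apply the axiom of Pos to a ∧ u and transpose.
  posJ-pos : ∀ {u v} → (PosJ u → LatOps._≤_ Lj u v) → LatOps._≤_ Lj u v
  posJ-pos {u} {v} h = below-fixed (proj₂ v) (pos-pos λ p → ≤-trans ∧-lb₂ (h p))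

  isPositivityJ : IsPositivity Lj PosJ
  isPositivityJ = record
    { pos-mono = λ {u} {v} → posJ-mono {u} {v}
    ; pos-join = posJ-join
    ; pos-pos  = λ {u} {v} → posJ-pos {u} {v}
    }

  -- Overlap: to get a ∧ u ≤ v in L, test against an arbitrary w ∈ L, passing
  -- to j w ∈ L_j; w ∧ (a ∧ u) ≤ a ∧ (j w ∧ u) by inflation, and
  -- a ∧ (j w ∧ v) ≤ w ∧ v by modus ponens.
  overlapJ : ∀ {u v} → (∀ z → PosJ (LatOps._∧_ Lj z u) → PosJ (LatOps._∧_ Lj z v))
           → LatOps._≤_ Lj u v
  overlapJ {u , _} {v , jv≡v} h = below-fixed jv≡v (overlap-ax λ w p →
      pos-mono (h (j w , idem) (pos-mono p into-jw)) out-of-jw)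
    where
      into-jw : ∀ {w} → (w ∧ (a ∧ u)) ≤ (a ∧ (j w ∧ u))
      into-jw = ∧-glb (≤-trans ∧-lb₂ ∧-lb₁) (∧-mono inflation ∧-lb₂)

      out-of-jw : ∀ {w} → (a ∧ (j w ∧ v)) ≤ (w ∧ v)
      out-of-jw = ∧-glb (≤-trans (∧-mono ≤-refl ∧-lb₁) modus-ponens) (≤-trans ∧-lb₂ ∧-lb₂)

  isOverlapAlgebraJ : IsOverlapAlgebra Lj PosJ
  isOverlapAlgebraJ = record
    { isPositivity = isPositivityJ
    ; overlap-ax   = λ {u} {v} → overlapJ {u} {v}
    }

proposition5p5 : ∀ {ℓ} (L : Frame ℓ) (Pos : Frame.Carrier L → Set ℓ)
    → IsOverlapAlgebra (Frame.ops L) Pos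
    → (N : Nucleus L) → IsOpen N
    → Σ[ PosJ ∈ (LatOps.Carrier (sublocale N) → Set ℓ) ] IsOverlapAlgebra (sublocale N) PosJ
proposition5p5 L Pos OA N (a , j-open) = PosJ , isOverlapAlgebraJ
  where open OpenSublocale L Pos OA N a j-open
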